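{- Let $R(x,y)$ be the generating function in which the coefficient of $x^ny^k$ is the number of non-decreasing Dyck paths with air pockets of length $n$ having $k$ returns to the $x$-axis. Then $$R(x,y)=\frac{x^2y(1-x)(1-x-x^2)}{(1-2x)(1-x-x^2y)}.$$
   Context: A Dyck path with air pockets is a non-empty lattice path in the first quadrant starting at the origin, ending on the $x$-axis, with up-steps $U=(1,1)$ and down-steps $D_k=(1,-k)$, $k\ge1$, no two down-steps consecutive; its length is its number of steps. A return to the $x$-axis is a step $D_m$ ($m\ge1$) ending on the $x$-axis. A valley is an occurrence of a factor $D_kU$, and its height is the ordinate of the point between $D_k$ and $U$. The path is non-decreasing if the heights of its valleys, read from left to right, form a non-decreasing sequence. -}

module Defs where

open import Data.Nat using (ℕ; zero; suc; _+_; _∸_; _≡ᵇ_; _≤ᵇ_)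
open import Data.Bool using (Bool; true; false; _∧_; not; if_then_else_)
open import Data.List using (List; []; _∷_; map; concatMap; upTo)
import Data.Integer as ℤ
open ℤ using (ℤ)

-- Steps of a Dyck path with air pockets: U = (1,1), D k = (1,-k).
-- (The step D k is only admissible when k ≥ 1; this is checked in 'valid'.)

data Step : Set where
  U : Step
  D : ℕ → Step

valid : ℕ → Bool → List Step → Bool
valid h p []          = h ≡ᵇ 0
valid h p (U ∷ s)     = valid (suc h) false s
valid h p (D k ∷ s)   = not p ∧ (1 ≤ᵇ k) ∧ (k ≤ᵇ h) ∧ valid (h ∸ k) true s

nonEmpty : List Step → Bool
nonEmpty []      = false
nonEmpty (_ ∷ _) = true

isDAP : List Step → Bool
isDAP w = nonEmpty w ∧ valid 0 false w

valleys : ℕ → List Step → List ℕ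
valleys h []              = []
valleys h (U ∷ s)         = valleys (suc h) s
valleys h (D k ∷ [])      = []
valleys h (D k ∷ U ∷ s)   = (h ∸ k) ∷ valleys (h ∸ k) (U ∷ s)
valleys h (D k ∷ D j ∷ s) = valleys (h ∸ k) (D j ∷ s)

nonDecreasing : List ℕ → Bool
nonDecreasing []           = true
nonDecreasing (a ∷ [])     = true
nonDecreasing (a ∷ b ∷ l)  = (a ≤ᵇ b) ∧ nonDecreasing (b ∷ l)

isNDAP : List Step → Bool
isNDAP w = isDAP w ∧ nonDecreasing (valleys 0 w)

returns : ℕ → List Step → ℕ
returns h []        = 0
returns h (U ∷ s)   = returns (suc h) s
returns h (D k ∷ s) = (if (h ∸ k) ≡ᵇ 0 then 1 else 0) + returns (h ∸ k) s

words : List Step → ℕ → List (List Step)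
words A zero    = [] ∷ []
words A (suc m) = concatMap (λ w → map (λ a → a ∷ w) A) (words A m)

-- Alphabet sufficient for paths of length n: U, D 1, …, D n.
alphabet : ℕ → List Step
alphabet n = U ∷ map (λ i → D (suc i)) (upTo n)

countTrue : {A : Set} → (A → Bool) → List A → ℕ
countTrue f []      = 0
countTrue f (x ∷ l) = (if f x then 1 else 0) + countTrue f l

r : ℕ → ℕ → ℕ
r n k = countTrue (λ w → isNDAP w ∧ (returns 0 w ≡ᵇ k)) (words (alphabet n) n)

-- Formal power series in x, y over ℤ: coefficient of x^n y^k.

Series : Set
Series = ℕ → ℕ → ℤ

sumTo : ℕ → (ℕ → ℤ) → ℤ
sumTo zero    f = f 0
sumTo (suc n) f = sumTo n f ℤ.+ f (suc n)

_⊕_ : Series → Series → Series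
(f ⊕ g) n k = f n k ℤ.+ g n k

_⊖_ : Series → Series → Series
(f ⊖ g) n k = f n k ℤ.- g n k

_⊗_ : Series → Series → Series
(f ⊗ g) n k = sumTo n (λ i → sumTo k (λ j → f i j ℤ.* g (n ∸ i) (k ∸ j)))

infixl 6 _⊕_ _⊖_
infixl 7 _⊗_

mono : ℤ → ℕ → ℕ → Series
mono c a b n k = if (n ≡ᵇ a) ∧ (k ≡ᵇ b) then c else ℤ.0ℤ

one X Y : Series
one = mono ℤ.1ℤ 0 0
X   = mono ℤ.1ℤ 1 0
Y   = mono ℤ.1ℤ 0 1

R : Series
R n k = ℤ.+ (r n k)

-- A path is read step by step in a state made of its height, whether the last step
-- went down, and the height of its last valley.  Once a valley at positive height has
-- occurred the path cannot touch the x-axis before its last step, and the number of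
-- completions of length m from such a state is a power of 2 (times a linear factor
-- after an up-step).  Counting words by their first letter then yields
--   r(m+2, k+1) = r(m+1, k+1) + r(m, k) + [k = 0] d(m),   d = 1, 0, 0, 1, 2, 4, 8, …,
-- that is R (1 - x - x²y) = x²y + x⁵y/(1-2x); multiplying by 1 - 2x gives the theorem,
-- which is checked coefficient by coefficient.
module Submission where

open import Defs
open import Data.Bool using (Bool; true; false; _∧_; not; if_then_else_; T)
open import Data.Bool.Properties using (∧-zeroʳ; ∧-assoc; if-∧; if-cong-then)
open import Data.Empty using (⊥-elim)
open import Data.Integer as ℤ using (ℤ; 0ℤ; 1ℤ)
import Data.Integer.Properties as ℤₚ
open import Data.Integer.Tactic.RingSolver using () renaming (solve-∀ to solve-∀ℤ)
open import Data.List using (List; []; _∷_; _++_; map; concatMap; applyUpTo)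
open import Data.List.Properties using (map-applyUpTo)
open import Data.Nat using (ℕ; zero; suc; _+_; _*_; _∸_; _^_; _≡ᵇ_; _≤ᵇ_; _≤_; _<_; _≤?_; z≤n; s≤s)
open import Data.Nat.ListAction using (sum)
open import Data.Nat.Properties
open import Algebra.Properties.CommutativeSemigroup +-commutativeSemigroup using (interchange; x∙yz≈y∙xz)
open import Algebra.Properties.CommutativeSemigroup ℤₚ.+-commutativeSemigroup using ()
  renaming (interchange to ℤ-interchange)
open import Data.Nat.Tactic.RingSolver using (solve-∀)
open import Function using (_∘_)
open import Relation.Binary.PropositionalEquality
open import Relation.Nullary using (¬_; yes; no)

if-T : ∀ {A : Set} {b} {x y : A} → T b → (if b then x else y) ≡ x
if-T {b = true} _ = refl

if-¬T : ∀ {A : Set} {b} {x y : A} → ¬ T b → (if b then x else y) ≡ y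
if-¬T {b = true}  ¬t = ⊥-elim (¬t _)
if-¬T {b = false} _  = refl

sum-map-+ : {A : Set} (f g : A → ℕ) (xs : List A) →
  sum (map (λ x → f x + g x) xs) ≡ sum (map f xs) + sum (map g xs)
sum-map-+ f g []       = refl
sum-map-+ f g (x ∷ xs) = begin
  f x + g x + sum (map (λ x → f x + g x) xs)      ≡⟨ cong (f x + g x +_) (sum-map-+ f g xs) ⟩
  f x + g x + (sum (map f xs) + sum (map g xs))   ≡⟨ interchange (f x) (g x) _ _ ⟩
  f x + sum (map f xs) + (g x + sum (map g xs))   ∎
  where open ≡-Reasoning

sum-map-0 : {A : Set} (xs : List A) → sum (map (λ _ → 0) xs) ≡ 0
sum-map-0 []       = refl
sum-map-0 (x ∷ xs) = sum-map-0 xs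

sum-applyUpTo-0 : (f : ℕ → ℕ) → (∀ i → f i ≡ 0) → ∀ n → sum (applyUpTo f n) ≡ 0
sum-applyUpTo-0 f f≡0 zero    = refl
sum-applyUpTo-0 f f≡0 (suc n) = cong₂ _+_ (f≡0 0) (sum-applyUpTo-0 (f ∘ suc) (f≡0 ∘ suc) n)

sum-applyUpTo-cong : {f g : ℕ → ℕ} → (∀ i → f i ≡ g i) → ∀ n → sum (applyUpTo f n) ≡ sum (applyUpTo g n)
sum-applyUpTo-cong f≡g zero    = refl
sum-applyUpTo-cong f≡g (suc n) = cong₂ _+_ (f≡g 0) (sum-applyUpTo-cong (f≡g ∘ suc) n)

countTrue-cong : {A : Set} {f g : A → Bool} → (∀ x → f x ≡ g x) → ∀ xs → countTrue f xs ≡ countTrue g xs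
countTrue-cong f≡g []       = refl
countTrue-cong f≡g (x ∷ xs) = cong₂ (λ b n → (if b then 1 else 0) + n) (f≡g x) (countTrue-cong f≡g xs)

countTrue-false : {A : Set} (xs : List A) → countTrue (λ _ → false) xs ≡ 0
countTrue-false []       = refl
countTrue-false (x ∷ xs) = countTrue-false xs

countTrue-∧ : {A : Set} (b : Bool) (f : A → Bool) (xs : List A) →
  countTrue (λ x → b ∧ f x) xs ≡ (if b then countTrue f xs else 0)
countTrue-∧ true  f xs = refl
countTrue-∧ false f xs = countTrue-false xs

countTrue-++ : {A : Set} (f : A → Bool) (xs ys : List A) →
  countTrue f (xs ++ ys) ≡ countTrue f xs + countTrue f ys
countTrue-++ f []       ys = refl
countTrue-++ f (x ∷ xs) ys =
  trans (cong (b +_) (countTrue-++ f xs ys)) (sym (+-assoc b (countTrue f xs) _))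
  where b = if f x then 1 else 0

countTrue-map-sum : {A B : Set} (f : B → Bool) (g : A → B) (xs : List A) →
  countTrue f (map g xs) ≡ sum (map (λ x → if f (g x) then 1 else 0) xs)
countTrue-map-sum f g []       = refl
countTrue-map-sum f g (x ∷ xs) = cong (_ +_) (countTrue-map-sum f g xs)

countTrue-words-suc : (f : List Step → Bool) (A : List Step) (m : ℕ) →
  countTrue f (words A (suc m)) ≡ sum (map (λ a → countTrue (f ∘ (a ∷_)) (words A m)) A)
countTrue-words-suc f A m = go (words A m)
  where
  open ≡-Reasoning
  go : ∀ ws → countTrue f (concatMap (λ w → map (_∷ w) A) ws)
            ≡ sum (map (λ a → countTrue (f ∘ (a ∷_)) ws) A)
  go []       = sym (sum-map-0 A)
  go (w ∷ ws) = begin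
    countTrue f (map (_∷ w) A ++ concatMap (λ w → map (_∷ w) A) ws)
      ≡⟨ countTrue-++ f (map (_∷ w) A) _ ⟩
    countTrue f (map (_∷ w) A) + countTrue f (concatMap (λ w → map (_∷ w) A) ws)
      ≡⟨ cong₂ _+_ (countTrue-map-sum f (_∷ w) A) (go ws) ⟩
    sum (map (λ a → if f (a ∷ w) then 1 else 0) A) + sum (map (λ a → countTrue (f ∘ (a ∷_)) ws) A)
      ≡⟨ sym (sum-map-+ _ _ A) ⟩
    sum (map (λ a → countTrue (f ∘ (a ∷_)) (w ∷ ws)) A) ∎

countTrue-alphabet-suc : (N m : ℕ) (f : List Step → Bool) →
  countTrue f (words (alphabet N) (suc m))
    ≡ countTrue (f ∘ (U ∷_)) (words (alphabet N) m)
      + sum (applyUpTo (λ i → countTrue (f ∘ (D (suc i) ∷_)) (words (alphabet N) m)) N)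
countTrue-alphabet-suc N m f = trans (countTrue-words-suc f (alphabet N) m)
  (cong (countTrue (f ∘ (U ∷_)) (words (alphabet N) m) +_)
    (cong sum (trans (cong (map count) (map-applyUpTo (λ i → i) (λ i → D (suc i)) N))
                     (map-applyUpTo (λ i → D (suc i)) count N))))
  where
  count : Step → ℕ
  count a = countTrue (f ∘ (a ∷_)) (words (alphabet N) m)

sumBelow : ℕ → (ℕ → ℕ) → ℕ
sumBelow zero    F = 0
sumBelow (suc h) F = F h + sumBelow h F

sumBelow-suc-front : ∀ h F → sumBelow (suc h) F ≡ F 0 + sumBelow h (F ∘ suc)
sumBelow-suc-front zero    F = refl
sumBelow-suc-front (suc h) F = begin
  F (suc h) + sumBelow (suc h) F             ≡⟨ cong (F (suc h) +_) (sumBelow-suc-front h F) ⟩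
  F (suc h) + (F 0 + sumBelow h (F ∘ suc))   ≡⟨ x∙yz≈y∙xz (F (suc h)) (F 0) _ ⟩
  F 0 + (F (suc h) + sumBelow h (F ∘ suc))   ∎
  where open ≡-Reasoning

sumBelow-zero : ∀ a F → (∀ i → i < a → F i ≡ 0) → sumBelow a F ≡ 0
sumBelow-zero zero    F F≡0 = refl
sumBelow-zero (suc a) F F≡0 =
  cong₂ _+_ (F≡0 a ≤-refl) (sumBelow-zero a F (λ i i<a → F≡0 i (m≤n⇒m≤1+n i<a)))

sumBelow-step : ∀ a d c F → (∀ i → i < a → F i ≡ 0) → (∀ i → a ≤ i → i < a + d → F i ≡ c) →
  sumBelow (a + d) F ≡ d * c
sumBelow-step a zero c F F≡0 F≡c rewrite +-identityʳ a = sumBelow-zero a F F≡0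
sumBelow-step a (suc d) c F F≡0 F≡c rewrite +-suc a d =
  cong₂ _+_ (F≡c (a + d) (m≤m+n a d) ≤-refl)
            (sumBelow-step a d c F F≡0 (λ i a≤i i<a+d → F≡c i a≤i (m≤n⇒m≤1+n i<a+d)))

-- The down-step D (1+i) taken at height h lands at h ∸ (1+i); for i < h these heights
-- run through h-1, …, 0.
sum-landings : ∀ N h F → h ≤ N →
  sum (applyUpTo (λ i → if suc i ≤ᵇ h then F (h ∸ suc i) else 0) N) ≡ sumBelow h F
sum-landings N       zero    F _         = sum-applyUpTo-0 _ (λ _ → refl) N
sum-landings (suc N) (suc h) F (s≤s h≤N) = cong (F h +_) (sum-landings N h F h≤N)

-- Non-decreasing paths as accepted words

valleysFrom : ℕ → Bool → List Step → List ℕ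
valleysFrom h p     []        = []
valleysFrom h false (U ∷ w)   = valleysFrom (suc h) false w
valleysFrom h true  (U ∷ w)   = h ∷ valleysFrom (suc h) false w
valleysFrom h p     (D j ∷ w) = valleysFrom (h ∸ j) true w

nondecreasingFrom : ℕ → List ℕ → Bool
nondecreasingFrom v []       = true
nondecreasingFrom v (a ∷ l) = (v ≤ᵇ a) ∧ nondecreasingFrom a l

valleys≡valleysFrom : ∀ h w → valleys h w ≡ valleysFrom h false w
valleys≡valleysFrom h []              = refl
valleys≡valleysFrom h (U ∷ w)         = valleys≡valleysFrom (suc h) w
valleys≡valleysFrom h (D k ∷ [])      = refl
valleys≡valleysFrom h (D k ∷ U ∷ w)   = cong ((h ∸ k) ∷_) (valleys≡valleysFrom (suc (h ∸ k)) w)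
valleys≡valleysFrom h (D k ∷ D j ∷ w) = valleys≡valleysFrom (h ∸ k) (D j ∷ w)

nonDecreasing≡nondecreasingFrom0 : ∀ l → nonDecreasing l ≡ nondecreasingFrom 0 l
nonDecreasing≡nondecreasingFrom0 []      = refl
nonDecreasing≡nondecreasingFrom0 (a ∷ l) = go a l
  where
  go : ∀ a l → nonDecreasing (a ∷ l) ≡ nondecreasingFrom a l
  go a []      = refl
  go a (b ∷ l) = cong ((a ≤ᵇ b) ∧_) (go b l)

-- ndSuffix h p v k w: read from height h, where p says whether the previous step went
-- down and v is the height of the last valley (0 if there is none yet), w is a valid
-- non-decreasing continuation with exactly k returns.  landed l v k w is the same test
-- right after a down-step to height l, which is a return when l = 0.
mutual
  ndSuffix : ℕ → Bool → ℕ → ℕ → List Step → Bool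
  ndSuffix h p     v k []        = (h ≡ᵇ 0) ∧ (0 ≡ᵇ k)
  ndSuffix h false v k (U ∷ w)   = ndSuffix (suc h) false v k w
  ndSuffix h true  v k (U ∷ w)   = (v ≤ᵇ h) ∧ ndSuffix (suc h) false h k w
  ndSuffix h p     v k (D j ∷ w) = not p ∧ ((1 ≤ᵇ j) ∧ ((j ≤ᵇ h) ∧ landed (h ∸ j) v k w))

  landed : ℕ → ℕ → ℕ → List Step → Bool
  landed zero    v zero    w = false
  landed zero    v (suc k) w = ndSuffix 0 true v k w
  landed (suc l) v k       w = ndSuffix (suc l) true v k w

ndSuffix-spec : ∀ h p v k w →
  (valid h p w ∧ (nondecreasingFrom v (valleysFrom h p w) ∧ (returns h w ≡ᵇ k))) ≡ ndSuffix h p v k w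
ndSuffix-spec h p     v k []      = refl
ndSuffix-spec h false v k (U ∷ w) = ndSuffix-spec (suc h) false v k w
ndSuffix-spec h true  v k (U ∷ w) with v ≤ᵇ h
... | true  = ndSuffix-spec (suc h) false h k w
... | false = ∧-zeroʳ (valid (suc h) false w)
ndSuffix-spec h true  v k (D j ∷ w) = refl
ndSuffix-spec h false v k (D j ∷ w) with 1 ≤ᵇ j | j ≤ᵇ h
... | false | _     = refl
... | true  | false = refl
... | true  | true  = landed-spec (h ∸ j) k
  where
  landed-spec : ∀ l k →
    (valid l true w ∧ (nondecreasingFrom v (valleysFrom l true w)
                       ∧ ((if l ≡ᵇ 0 then 1 else 0) + returns l w ≡ᵇ k)))
      ≡ landed l v k w
  landed-spec zero zero
    rewrite ∧-zeroʳ (nondecreasingFrom v (valleysFrom zero true w)) = ∧-zeroʳ (valid zero true w)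
  landed-spec zero    (suc k) = ndSuffix-spec 0 true v k w
  landed-spec (suc l) k       = ndSuffix-spec (suc l) true v k w

isNDAP-returns-spec : ∀ k w → (isNDAP w ∧ (returns 0 w ≡ᵇ k)) ≡ (nonEmpty w ∧ ndSuffix 0 false 0 k w)
isNDAP-returns-spec k w = begin
  ((nonEmpty w ∧ valid 0 false w) ∧ nonDecreasing (valleys 0 w)) ∧ (returns 0 w ≡ᵇ k)
    ≡⟨ cong (λ b → ((nonEmpty w ∧ valid 0 false w) ∧ b) ∧ (returns 0 w ≡ᵇ k))
            (trans (nonDecreasing≡nondecreasingFrom0 (valleys 0 w))
                   (cong (nondecreasingFrom 0) (valleys≡valleysFrom 0 w))) ⟩
  ((nonEmpty w ∧ valid 0 false w) ∧ nd) ∧ (returns 0 w ≡ᵇ k)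
    ≡⟨ ∧-assoc (nonEmpty w ∧ valid 0 false w) nd _ ⟩
  (nonEmpty w ∧ valid 0 false w) ∧ (nd ∧ (returns 0 w ≡ᵇ k))
    ≡⟨ ∧-assoc (nonEmpty w) (valid 0 false w) _ ⟩
  nonEmpty w ∧ (valid 0 false w ∧ (nd ∧ (returns 0 w ≡ᵇ k)))
    ≡⟨ cong (nonEmpty w ∧_) (ndSuffix-spec 0 false 0 k w) ⟩
  nonEmpty w ∧ ndSuffix 0 false 0 k w ∎
  where
  open ≡-Reasoning
  nd = nondecreasingFrom 0 (valleysFrom 0 false w)

-- Counting completions

isZero isOne : ℕ → ℕ
isZero zero    = 1
isZero (suc _) = 0
isOne zero    = 0
isOne (suc k) = isZero k

tailsDown : ℕ → ℕ
tailsDown 0                   = 0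
tailsDown 1                   = 0
tailsDown 2                   = 1
tailsDown (suc (suc (suc m))) = 2 ^ m

tailsUp : ℕ → ℕ → ℕ
tailsUp 0                   d = 0
tailsUp 1                   d = 1
tailsUp 2                   d = 1
tailsUp (suc (suc (suc m))) d = suc d * 2 ^ m

tailsUp-1 : ∀ m → tailsUp m 1 ≡ tailsDown (suc m)
tailsUp-1 0                   = refl
tailsUp-1 1                   = refl
tailsUp-1 2                   = refl
tailsUp-1 (suc (suc (suc m))) = refl

tailsUp-suc : ∀ m d → tailsUp (suc m) d ≡ tailsUp m (suc d) + (isZero m + d * tailsDown m)
tailsUp-suc 0                   d = cong suc (sym (*-zeroʳ d))
tailsUp-suc 1                   d = cong suc (sym (*-zeroʳ d))
tailsUp-suc 2                   d = refl
tailsUp-suc (suc (suc (suc m))) d = doubling d (2 ^ m)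
  where
  doubling : ∀ d x → suc d * (2 * x) ≡ suc (suc d) * x + d * x
  doubling = solve-∀

-- ρ agrees with r in positive length (r≡ρ), but ρ 0 0 = 1 counts the empty path, as the
-- counts of completions from the ground state require.
mutual
  ρ : ℕ → ℕ → ℕ
  ρ zero          zero    = 1
  ρ zero          (suc k) = 0
  ρ (suc zero)    k       = 0
  ρ (suc (suc m)) k       = ρ (suc m) k + ρ↓ m k + isOne k * sumBelow m tailsDown

  ρ↓ : ℕ → ℕ → ℕ
  ρ↓ m zero    = 0
  ρ↓ m (suc k) = ρ m k

-- Words are drawn from alphabet N; the bounds h + m ≤ N below make sure that every
-- down-step a completion of length m from height h may need is available.
module Counting (N : ℕ) where

  W : ℕ → List (List Step)
  W = words (alphabet N)

  count : ℕ → ℕ → Bool → ℕ → ℕ → ℕ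
  count m h p v k = countTrue (ndSuffix h p v k) (W m)

  countLanded : ℕ → ℕ → ℕ → ℕ → ℕ
  countLanded m v k l = countTrue (landed l v k) (W m)

  count-suc-afterUp : ∀ m h v k → h ≤ N →
    count (suc m) h false v k ≡ count m (suc h) false v k + sumBelow h (countLanded m v k)
  count-suc-afterUp m h v k h≤N = trans (countTrue-alphabet-suc N m (ndSuffix h false v k))
    (cong (count m (suc h) false v k +_)
      (trans (sum-applyUpTo-cong (λ i → countTrue-∧ (suc i ≤ᵇ h) (landed (h ∸ suc i) v k) (W m)) N)
             (sum-landings N h (countLanded m v k) h≤N)))

  count-suc-afterDown : ∀ m h v k →
    count (suc m) h true v k ≡ (if v ≤ᵇ h then count m (suc h) false h k else 0)
  count-suc-afterDown m h v k = trans (countTrue-alphabet-suc N m (ndSuffix h true v k))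
    (trans (cong₂ _+_ (countTrue-∧ (v ≤ᵇ h) (ndSuffix (suc h) false h k) (W m))
                      (sum-applyUpTo-0 _ (λ _ → countTrue-false (W m)) N))
           (+-identityʳ _))

  count-suc-ground₀ : ∀ m p k → count (suc m) 0 p 0 k ≡ count m 1 false 0 k
  count-suc-ground₀ m false k = trans (count-suc-afterUp m 0 0 k z≤n) (+-identityʳ _)
  count-suc-ground₀ m true  k = count-suc-afterDown m 0 0 k

  count-afterDown-blocked : ∀ m l v k → suc l < v → count m (suc l) true v k ≡ 0
  count-afterDown-blocked zero    l v k _   = refl
  count-afterDown-blocked (suc m) l v k l<v = trans (count-suc-afterDown m (suc l) v k)
    (if-¬T (λ v≤l → <⇒≱ l<v (≤ᵇ⇒≤ v (suc l) v≤l)))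

  countLanded-ground : ∀ m v k → countLanded m (suc v) k 0 ≡ isOne k * isZero m
  countLanded-ground m       v zero          = countTrue-false (W m)
  countLanded-ground zero    v (suc zero)    = refl
  countLanded-ground zero    v (suc (suc k)) = refl
  countLanded-ground (suc m) v (suc k)       =
    trans (count-suc-afterDown m 0 (suc v) k) (sym (*-zeroʳ (isOne (suc k))))

  shift-bound : ∀ a m → a + suc m ≤ N → suc a + m ≤ N
  shift-bound a m = subst (_≤ N) (+-suc a m)

  -- At positive height the path can only return once more, at its last step,
  -- since a later valley at height 0 would lie below the current one.
  mutual
    count-afterDown : ∀ m h v k → v ≤ suc h → suc h + m ≤ N →
      count m (suc h) true v k ≡ isOne k * tailsDown m
    count-afterDown zero    h v k _     _     = sym (*-zeroʳ (isOne k))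
    count-afterDown (suc m) h v k v≤1+h bound = begin
      count (suc m) (suc h) true v k
        ≡⟨ trans (count-suc-afterDown m (suc h) v k) (if-T (≤⇒≤ᵇ v≤1+h)) ⟩
      count m (suc (suc h)) false (suc h) k
        ≡⟨ count-afterUp m (suc h) h k (n≤1+n h) (shift-bound (suc h) m bound) ⟩
      isOne k * tailsUp m (suc h ∸ h)
        ≡⟨ cong (λ d → isOne k * tailsUp m d) (m+n∸n≡m 1 h) ⟩
      isOne k * tailsUp m 1
        ≡⟨ cong (isOne k *_) (tailsUp-1 m) ⟩
      isOne k * tailsDown (suc m) ∎
      where open ≡-Reasoning

    count-afterUp : ∀ m h v k → v ≤ h → suc h + m ≤ N →
      count m (suc h) false (suc v) k ≡ isOne k * tailsUp m (h ∸ v)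
    count-afterUp zero    h v k _   _     = sym (*-zeroʳ (isOne k))
    count-afterUp (suc m) h v k v≤h bound = begin
      count (suc m) (suc h) false (suc v) k
        ≡⟨ count-suc-afterUp m (suc h) (suc v) k (≤-trans (m≤m+n (suc h) (suc m)) bound) ⟩
      count m (suc (suc h)) false (suc v) k + sumBelow (suc h) (countLanded m (suc v) k)
        ≡⟨ cong₂ _+_ (count-afterUp m (suc h) v k (m≤n⇒m≤1+n v≤h) (shift-bound (suc h) m bound))
                     (sumBelow-suc-front h (countLanded m (suc v) k)) ⟩
      isOne k * tailsUp m (suc h ∸ v)
        + (countLanded m (suc v) k 0 + sumBelow h (λ i → count m (suc i) true (suc v) k))
        ≡⟨ cong₂ (λ d s → isOne k * tailsUp m d + s) (+-∸-assoc 1 v≤h)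
                 (cong₂ _+_ (countLanded-ground m v k) landings) ⟩
      isOne k * tailsUp m (suc (h ∸ v)) + (isOne k * isZero m + (h ∸ v) * (isOne k * tailsDown m))
        ≡⟨ factor (isOne k) _ _ _ (h ∸ v) ⟩
      isOne k * (tailsUp m (suc (h ∸ v)) + (isZero m + (h ∸ v) * tailsDown m))
        ≡⟨ cong (isOne k *_) (sym (tailsUp-suc m (h ∸ v))) ⟩
      isOne k * tailsUp (suc m) (h ∸ v) ∎
      where
      open ≡-Reasoning
      factor : ∀ i a b c d → i * a + (i * b + d * (i * c)) ≡ i * (a + (b + d * c))
      factor = solve-∀
      landings : sumBelow h (λ i → count m (suc i) true (suc v) k) ≡ (h ∸ v) * (isOne k * tailsDown m)
      landings = trans (cong (λ x → sumBelow x _) (sym (m+[n∸m]≡n v≤h)))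
        (sumBelow-step v (h ∸ v) _ _
          (λ i i<v → count-afterDown-blocked m i (suc v) k (s≤s i<v))
          (λ i v≤i i<h → count-afterDown m i (suc v) k (s≤s v≤i)
             (≤-trans (+-mono-≤ (m≤n⇒m≤1+n (subst (i <_) (m+[n∸m]≡n v≤h) i<h)) (n≤1+n m)) bound)))

  mutual
    count-ground₀ : ∀ m p k → m ≤ N → count m 0 p 0 k ≡ ρ m k
    count-ground₀ zero    p zero    _     = refl
    count-ground₀ zero    p (suc k) _     = refl
    count-ground₀ (suc m) p k       bound = trans (count-suc-ground₀ m p k)
      (trans (count-afterUp₀ m 0 k bound) (+-identityʳ (ρ (suc m) k)))

    countLanded-ground₀ : ∀ m k → m ≤ N → countLanded m 0 k 0 ≡ ρ↓ m k
    countLanded-ground₀ m zero    _     = countTrue-false (W m)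
    countLanded-ground₀ m (suc k) bound = count-ground₀ m true k bound

    count-afterUp₀ : ∀ m h k → suc h + m ≤ N →
      count m (suc h) false 0 k ≡ ρ (suc m) k + h * (isOne k * sumBelow m tailsDown)
    count-afterUp₀ zero    h k _     =
      sym (trans (cong (h *_) (*-zeroʳ (isOne k))) (*-zeroʳ h))
    count-afterUp₀ (suc m) h k bound = begin
      count (suc m) (suc h) false 0 k
        ≡⟨ count-suc-afterUp m (suc h) 0 k (≤-trans (m≤m+n (suc h) (suc m)) bound) ⟩
      count m (suc (suc h)) false 0 k + sumBelow (suc h) (countLanded m 0 k)
        ≡⟨ cong₂ _+_ (count-afterUp₀ m (suc h) k (shift-bound (suc h) m bound))
                     (sumBelow-suc-front h (countLanded m 0 k)) ⟩
      ρ (suc m) k + suc h * (isOne k * S)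
        + (countLanded m 0 k 0 + sumBelow h (λ i → count m (suc i) true 0 k))
        ≡⟨ cong (ρ (suc m) k + suc h * (isOne k * S) +_)
                (cong₂ _+_ (countLanded-ground₀ m k
                              (≤-trans (m≤n+m m (suc (suc h))) (shift-bound (suc h) m bound)))
                           landings) ⟩
      ρ (suc m) k + suc h * (isOne k * S) + (ρ↓ m k + h * (isOne k * tailsDown m))
        ≡⟨ regroup (ρ (suc m) k) (ρ↓ m k) (isOne k) S (tailsDown m) h ⟩
      ρ (suc m) k + ρ↓ m k + isOne k * S + h * (isOne k * (tailsDown m + S)) ∎
      where
      open ≡-Reasoning
      S = sumBelow m tailsDown
      regroup : ∀ a b i s t h → a + suc h * (i * s) + (b + h * (i * t)) ≡ a + b + i * s + h * (i * (t + s))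
      regroup = solve-∀
      landings : sumBelow h (λ i → count m (suc i) true 0 k) ≡ h * (isOne k * tailsDown m)
      landings = sumBelow-step 0 h _ _ (λ _ ())
        (λ i _ i<h → count-afterDown m i 0 k z≤n
           (≤-trans (+-mono-≤ (m≤n⇒m≤1+n i<h) (n≤1+n m)) bound))

r≡ρ : ∀ m k → r (suc m) k ≡ ρ (suc m) k
r≡ρ m k = begin
  countTrue (λ w → isNDAP w ∧ (returns 0 w ≡ᵇ k)) (W (suc m))
    ≡⟨ countTrue-cong (isNDAP-returns-spec k) (W (suc m)) ⟩
  countTrue (λ w → nonEmpty w ∧ ndSuffix 0 false 0 k w) (W (suc m))
    ≡⟨ countTrue-words-suc _ (alphabet (suc m)) m ⟩
  -- nonEmpty (a ∷ w) reduces to true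
  sum (map (λ a → countTrue (λ w → ndSuffix 0 false 0 k (a ∷ w)) (W m)) (alphabet (suc m)))
    ≡⟨ countTrue-words-suc _ (alphabet (suc m)) m ⟨
  count (suc m) 0 false 0 k
    ≡⟨ count-ground₀ (suc m) false k ≤-refl ⟩
  ρ (suc m) k ∎
  where
  open ≡-Reasoning
  open Counting (suc m)

-- d m is the coefficient of x^(m+2) y in R(x,y)(1 - x - x²y) = x²y + x⁵y/(1-2x).
d : ℕ → ℕ
d 0                   = 1
d 1                   = 0
d 2                   = 0
d (suc (suc (suc j))) = 2 ^ j

sumBelow-tailsDown : ∀ m → sumBelow (suc m) tailsDown ≡ d (suc m)
sumBelow-tailsDown 0                   = refl
sumBelow-tailsDown 1                   = refl
sumBelow-tailsDown 2                   = refl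
sumBelow-tailsDown (suc (suc (suc j))) =
  cong (2 ^ j +_) (trans (sumBelow-tailsDown (suc (suc j))) (sym (+-identityʳ (2 ^ j))))

r-recurrence : ∀ m k → r (suc (suc m)) (suc k) ≡ r (suc m) (suc k) + r m k + isZero k * d m
r-recurrence zero    zero    = r≡ρ 1 1
r-recurrence zero    (suc k) = r≡ρ 1 (suc (suc k))
r-recurrence (suc m) k       = begin
  r (suc (suc (suc m))) (suc k)
    ≡⟨ r≡ρ (suc (suc m)) (suc k) ⟩
  ρ (suc (suc m)) (suc k) + ρ (suc m) k + isZero k * sumBelow (suc m) tailsDown
    ≡⟨ cong₂ (λ a b → a + b + isZero k * sumBelow (suc m) tailsDown)
             (sym (r≡ρ (suc m) (suc k))) (sym (r≡ρ m k)) ⟩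
  r (suc (suc m)) (suc k) + r (suc m) k + isZero k * sumBelow (suc m) tailsDown
    ≡⟨ cong (λ x → r (suc (suc m)) (suc k) + r (suc m) k + isZero k * x) (sumBelow-tailsDown m) ⟩
  r (suc (suc m)) (suc k) + r (suc m) k + isZero k * d (suc m) ∎
  where open ≡-Reasoning

r-no-returns : ∀ n → r n 0 ≡ 0
r-no-returns zero    = refl
r-no-returns (suc m) = trans (r≡ρ m 0) (ρ-no-returns m)
  where
  ρ-no-returns : ∀ m → ρ (suc m) 0 ≡ 0
  ρ-no-returns zero    = refl
  ρ-no-returns (suc m) =
    trans (+-identityʳ (ρ (suc m) 0 + 0)) (trans (+-identityʳ (ρ (suc m) 0)) (ρ-no-returns m))

-- Formal power series

infix 4 _≐_
_≐_ : Series → Series → Set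
f ≐ g = ∀ n k → f n k ≡ g n k

sumTo-cong : ∀ n {f g : ℕ → ℤ} → (∀ i → f i ≡ g i) → sumTo n f ≡ sumTo n g
sumTo-cong zero    f≡g = f≡g 0
sumTo-cong (suc n) f≡g = cong₂ ℤ._+_ (sumTo-cong n f≡g) (f≡g (suc n))

sumTo-+ : ∀ n (f g : ℕ → ℤ) → sumTo n (λ i → f i ℤ.+ g i) ≡ sumTo n f ℤ.+ sumTo n g
sumTo-+ zero    f g = refl
sumTo-+ (suc n) f g = trans (cong (ℤ._+ (f (suc n) ℤ.+ g (suc n))) (sumTo-+ n f g))
  (ℤ-interchange (sumTo n f) (sumTo n g) (f (suc n)) (g (suc n)))

sumTo-neg : ∀ n (f : ℕ → ℤ) → sumTo n (λ i → ℤ.- f i) ≡ ℤ.- sumTo n f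
sumTo-neg zero    f = refl
sumTo-neg (suc n) f =
  trans (cong (ℤ._+ ℤ.- f (suc n)) (sumTo-neg n f)) (sym (ℤₚ.neg-distrib-+ (sumTo n f) (f (suc n))))

sumTo-zero : ∀ n (g : ℕ → ℤ) → (∀ i → i ≤ n → g i ≡ 0ℤ) → sumTo n g ≡ 0ℤ
sumTo-zero zero    g g≡0 = g≡0 0 z≤n
sumTo-zero (suc n) g g≡0 =
  cong₂ ℤ._+_ (sumTo-zero n g (λ i i≤n → g≡0 i (m≤n⇒m≤1+n i≤n))) (g≡0 (suc n) ≤-refl)

sumTo-single : ∀ n m (g : ℕ → ℤ) → m ≤ n → (∀ i → i ≤ n → i ≢ m → g i ≡ 0ℤ) → sumTo n g ≡ g m
sumTo-single zero    zero g _     _   = refl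
sumTo-single (suc n) m    g m≤1+n g≡0 with m ≟ suc n
... | yes refl = trans
  (cong (ℤ._+ g (suc n)) (sumTo-zero n g (λ i i≤n → g≡0 i (m≤n⇒m≤1+n i≤n) (<⇒≢ (s≤s i≤n)))))
  (ℤₚ.+-identityˡ (g (suc n)))
... | no m≢1+n = trans
  (cong (λ x → sumTo n g ℤ.+ x) (g≡0 (suc n) ≤-refl (m≢1+n ∘ sym)))
  (trans (ℤₚ.+-identityʳ (sumTo n g))
         (sumTo-single n m g (≤-pred (≤∧≢⇒< m≤1+n m≢1+n)) (λ i i≤n → g≡0 i (m≤n⇒m≤1+n i≤n))))

sumTo-select : ∀ n a (h : ℕ → ℤ) →
  sumTo n (λ i → if n ∸ i ≡ᵇ a then h i else 0ℤ) ≡ (if a ≤ᵇ n then h (n ∸ a) else 0ℤ)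
sumTo-select n a h with a ≤? n
... | yes a≤n = trans
  (sumTo-single n (n ∸ a) _ (m∸n≤m n a)
    (λ i i≤n i≢n∸a → if-¬T (λ n∸i≡ᵇa →
      i≢n∸a (trans (sym (m∸[m∸n]≡n i≤n)) (cong (n ∸_) (≡ᵇ⇒≡ (n ∸ i) a n∸i≡ᵇa))))))
  (trans (if-T (≡⇒≡ᵇ (n ∸ (n ∸ a)) a (m∸[m∸n]≡n a≤n))) (sym (if-T (≤⇒≤ᵇ a≤n))))
... | no a≰n = trans
  (sumTo-zero n _ (λ i _ → if-¬T (λ n∸i≡ᵇa →
    a≰n (subst (_≤ n) (≡ᵇ⇒≡ (n ∸ i) a n∸i≡ᵇa) (m∸n≤m n i)))))
  (sym (if-¬T (a≰n ∘ ≤ᵇ⇒≤ a n)))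

sumTo-if : ∀ n b (g : ℕ → ℤ) → sumTo n (λ i → if b then g i else 0ℤ) ≡ (if b then sumTo n g else 0ℤ)
sumTo-if n true  g = refl
sumTo-if n false g = sumTo-zero n _ (λ _ _ → refl)

*-if : ∀ x b (c : ℤ) → x ℤ.* (if b then c else 0ℤ) ≡ (if b then x ℤ.* c else 0ℤ)
*-if x true  c = refl
*-if x false c = ℤₚ.*-zeroʳ x

⊗-congˡ : ∀ {f f′} g → f ≐ f′ → f ⊗ g ≐ f′ ⊗ g
⊗-congˡ g f≐f′ n k = sumTo-cong n (λ i → sumTo-cong k (λ j → cong (ℤ._* g (n ∸ i) (k ∸ j)) (f≐f′ i j)))

⊗-congʳ : ∀ f {g g′} → g ≐ g′ → f ⊗ g ≐ f ⊗ g′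
⊗-congʳ f g≐g′ n k = sumTo-cong n (λ i → sumTo-cong k (λ j → cong (f i j ℤ.*_) (g≐g′ (n ∸ i) (k ∸ j))))

⊗-distribˡ-⊕ : ∀ f g h → f ⊗ (g ⊕ h) ≐ f ⊗ g ⊕ f ⊗ h
⊗-distribˡ-⊕ f g h n k = trans
  (sumTo-cong n (λ i → trans (sumTo-cong k (λ j → ℤₚ.*-distribˡ-+ (f i j) _ _)) (sumTo-+ k _ _)))
  (sumTo-+ n _ _)

⊗-negʳ : ∀ f g n k → (f ⊗ (λ i j → ℤ.- g i j)) n k ≡ ℤ.- (f ⊗ g) n k
⊗-negʳ f g n k = trans
  (sumTo-cong n (λ i → trans (sumTo-cong k (λ j → sym (ℤₚ.neg-distribʳ-* (f i j) _))) (sumTo-neg k _)))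
  (sumTo-neg n _)

⊗-distribˡ-⊖ : ∀ f g h → f ⊗ (g ⊖ h) ≐ f ⊗ g ⊖ f ⊗ h
⊗-distribˡ-⊖ f g h n k =
  trans (⊗-distribˡ-⊕ f g (λ i j → ℤ.- h i j) n k) (cong (λ x → (f ⊗ g) n k ℤ.+ x) (⊗-negʳ f h n k))

-- shift f a b c is the series c xᵃ yᵇ f.
shift : Series → ℕ → ℕ → ℤ → Series
shift f a b c n k = if (a ≤ᵇ n) ∧ (b ≤ᵇ k) then f (n ∸ a) (k ∸ b) ℤ.* c else 0ℤ

shift-cong : ∀ {f g} a b c → f ≐ g → shift f a b c ≐ shift g a b c
shift-cong a b c f≐g n k = if-cong-then ((a ≤ᵇ n) ∧ (b ≤ᵇ k)) (cong (ℤ._* c) (f≐g (n ∸ a) (k ∸ b)))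

⊗-mono : ∀ f c a b → f ⊗ mono c a b ≐ shift f a b c
⊗-mono f c a b n k = begin
  sumTo n (λ i → sumTo k (λ j → f i j ℤ.* mono c a b (n ∸ i) (k ∸ j)))
    ≡⟨ sumTo-cong n (λ i → trans
         (sumTo-cong k (λ j → trans (*-if (f i j) _ c) (if-∧ (n ∸ i ≡ᵇ a))))
         (sumTo-if k (n ∸ i ≡ᵇ a) _)) ⟩
  sumTo n (λ i → if n ∸ i ≡ᵇ a then sumTo k (λ j → if k ∸ j ≡ᵇ b then f i j ℤ.* c else 0ℤ) else 0ℤ)
    ≡⟨ sumTo-cong n (λ i → if-cong-then (n ∸ i ≡ᵇ a) (sumTo-select k b (λ j → f i j ℤ.* c))) ⟩
  sumTo n (λ i → if n ∸ i ≡ᵇ a then (if b ≤ᵇ k then f i (k ∸ b) ℤ.* c else 0ℤ) else 0ℤ)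
    ≡⟨ sumTo-select n a _ ⟩
  (if a ≤ᵇ n then (if b ≤ᵇ k then f (n ∸ a) (k ∸ b) ℤ.* c else 0ℤ) else 0ℤ)
    ≡⟨ if-∧ (a ≤ᵇ n) ⟨
  shift f a b c n k ∎
  where open ≡-Reasoning

≤ᵇ-∧-∸-≡ᵇ : ∀ n a b → (a ≤ᵇ n) ∧ (n ∸ a ≡ᵇ b) ≡ (n ≡ᵇ a + b)
≤ᵇ-∧-∸-≡ᵇ n       zero          b = refl
≤ᵇ-∧-∸-≡ᵇ zero    (suc a)       b = refl
≤ᵇ-∧-∸-≡ᵇ (suc n) 1             b = refl
≤ᵇ-∧-∸-≡ᵇ (suc n) (suc (suc a)) b = ≤ᵇ-∧-∸-≡ᵇ n (suc a) b

shift-mono : ∀ c a b c′ a′ b′ → shift (mono c a b) a′ b′ c′ ≐ mono (c ℤ.* c′) (a′ + a) (b′ + b)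
shift-mono c a b c′ a′ b′ n k =
  trans (guards (a′ ≤ᵇ n) (b′ ≤ᵇ k) (n ∸ a′ ≡ᵇ a) (k ∸ b′ ≡ᵇ b))
        (cong₂ (λ s t → if s ∧ t then c ℤ.* c′ else 0ℤ) (≤ᵇ-∧-∸-≡ᵇ n a′ a) (≤ᵇ-∧-∸-≡ᵇ k b′ b))
  where
  guards : ∀ p q s t → (if p ∧ q then (if s ∧ t then c else 0ℤ) ℤ.* c′ else 0ℤ)
                        ≡ (if (p ∧ s) ∧ (q ∧ t) then c ℤ.* c′ else 0ℤ)
  guards false q     s     t     = refl
  guards true  false false t     = refl
  guards true  false true  t     = refl
  guards true  true  false t     = refl
  guards true  true  true  false = refl
  guards true  true  true  true  = refl

mono-⊗-mono : ∀ c a b c′ a′ b′ → mono c a b ⊗ mono c′ a′ b′ ≐ mono (c ℤ.* c′) (a′ + a) (b′ + b)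
mono-⊗-mono c a b c′ a′ b′ n k =
  trans (⊗-mono (mono c a b) c′ a′ b′ n k) (shift-mono c a b c′ a′ b′ n k)

x² : X ⊗ X ≐ mono 1ℤ 2 0
x² = mono-⊗-mono 1ℤ 1 0 1ℤ 1 0

x²y : X ⊗ X ⊗ Y ≐ mono 1ℤ 2 1
x²y n k = trans (⊗-congˡ Y x² n k) (mono-⊗-mono 1ℤ 2 0 1ℤ 0 1 n k)

⊗-one-minus-X : ∀ f → f ⊗ (one ⊖ X) ≐ shift f 0 0 1ℤ ⊖ shift f 1 0 1ℤ
⊗-one-minus-X f n k =
  trans (⊗-distribˡ-⊖ f one X n k) (cong₂ ℤ._-_ (⊗-mono f 1ℤ 0 0 n k) (⊗-mono f 1ℤ 1 0 n k))

denominator numerator : Series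
denominator = mono 1ℤ 0 0 ⊖ mono (ℤ.+ 3) 1 0 ⊕ mono (ℤ.+ 2) 2 0 ⊖ mono 1ℤ 2 1 ⊕ mono (ℤ.+ 2) 3 1
numerator   = mono 1ℤ 2 1 ⊖ mono (ℤ.+ 2) 3 1 ⊕ mono 1ℤ 5 1

denominator-expansion : (one ⊖ (X ⊕ X)) ⊗ (one ⊖ X ⊖ X ⊗ X ⊗ Y) ≐ denominator
denominator-expansion n k = begin
  (A ⊗ (one ⊖ X ⊖ X ⊗ X ⊗ Y)) n k
    ≡⟨ ⊗-distribˡ-⊖ A (one ⊖ X) (X ⊗ X ⊗ Y) n k ⟩
  (A ⊗ (one ⊖ X)) n k ℤ.- (A ⊗ (X ⊗ X ⊗ Y)) n k
    ≡⟨ cong₂ ℤ._-_ (⊗-one-minus-X A n k) (trans (⊗-congʳ A x²y n k) (⊗-mono A 1ℤ 2 1 n k)) ⟩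
  (shift A 0 0 1ℤ ⊖ shift A 1 0 1ℤ ⊖ shift A 2 1 1ℤ) n k
    ≡⟨ collect n k ⟩
  denominator n k ∎
  where
  open ≡-Reasoning
  A = one ⊖ (X ⊕ X)
  collect : shift A 0 0 1ℤ ⊖ shift A 1 0 1ℤ ⊖ shift A 2 1 1ℤ ≐ denominator
  collect 0 0                       = refl
  collect 0 (suc k)                 = refl
  collect 1 0                       = refl
  collect 1 (suc k)                 = refl
  collect 2 0                       = refl
  collect 2 1                       = refl
  collect 2 (suc (suc k))           = refl
  collect 3 0                       = refl
  collect 3 1                       = refl
  collect 3 (suc (suc k))           = refl
  collect (suc (suc (suc (suc n)))) 0       = refl
  collect (suc (suc (suc (suc n)))) (suc k) = refl

numerator-expansion : X ⊗ X ⊗ Y ⊗ (one ⊖ X) ⊗ (one ⊖ X ⊖ X ⊗ X) ≐ numerator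
numerator-expansion n k = begin
  (P ⊗ (one ⊖ X ⊖ X ⊗ X)) n k
    ≡⟨ ⊗-distribˡ-⊖ P (one ⊖ X) (X ⊗ X) n k ⟩
  (P ⊗ (one ⊖ X)) n k ℤ.- (P ⊗ (X ⊗ X)) n k
    ≡⟨ cong₂ ℤ._-_ (⊗-one-minus-X P n k) (trans (⊗-congʳ P x² n k) (⊗-mono P 1ℤ 2 0 n k)) ⟩
  (shift P 0 0 1ℤ ⊖ shift P 1 0 1ℤ ⊖ shift P 2 0 1ℤ) n k
    ≡⟨ cong₂ ℤ._-_ (cong₂ ℤ._-_ (shift-cong 0 0 1ℤ P≐P′ n k) (shift-cong 1 0 1ℤ P≐P′ n k))
                   (shift-cong 2 0 1ℤ P≐P′ n k) ⟩
  (shift P′ 0 0 1ℤ ⊖ shift P′ 1 0 1ℤ ⊖ shift P′ 2 0 1ℤ) n k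
    ≡⟨ collect n k ⟩
  numerator n k ∎
  where
  open ≡-Reasoning
  P = X ⊗ X ⊗ Y ⊗ (one ⊖ X)
  P′ = mono 1ℤ 2 1 ⊖ mono 1ℤ 3 1
  P≐P′ : P ≐ P′
  P≐P′ n k = trans (⊗-one-minus-X (X ⊗ X ⊗ Y) n k)
    (cong₂ ℤ._-_ (trans (shift-cong 0 0 1ℤ x²y n k) (shift-mono 1ℤ 2 1 1ℤ 0 0 n k))
                 (trans (shift-cong 1 0 1ℤ x²y n k) (shift-mono 1ℤ 2 1 1ℤ 1 0 n k)))
  collect : shift P′ 0 0 1ℤ ⊖ shift P′ 1 0 1ℤ ⊖ shift P′ 2 0 1ℤ ≐ numerator
  collect 0 k = refl
  collect 1 k = refl
  collect 2 0 = refl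
  collect 2 1 = refl
  collect 2 (suc (suc k)) = refl
  collect 3 0 = refl
  collect 3 1 = refl
  collect 3 (suc (suc k)) = refl
  collect 4 0 = refl
  collect 4 1 = refl
  collect 4 (suc (suc k)) = refl
  collect 5 0 = refl
  collect 5 1 = refl
  collect 5 (suc (suc k)) = refl
  collect (suc (suc (suc (suc (suc (suc n)))))) 0 = refl
  collect (suc (suc (suc (suc (suc (suc n)))))) (suc k) = refl

⊗-denominator : ∀ f → f ⊗ denominator ≐
  shift f 0 0 1ℤ ⊖ shift f 1 0 (ℤ.+ 3) ⊕ shift f 2 0 (ℤ.+ 2) ⊖ shift f 2 1 1ℤ ⊕ shift f 3 1 (ℤ.+ 2)
⊗-denominator f n k =
  trans (⊗-distribˡ-⊕ f (m₁ ⊖ m₂ ⊕ m₃ ⊖ m₄) m₅ n k) (cong₂ ℤ._+_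
    (trans (⊗-distribˡ-⊖ f (m₁ ⊖ m₂ ⊕ m₃) m₄ n k) (cong₂ ℤ._-_
      (trans (⊗-distribˡ-⊕ f (m₁ ⊖ m₂) m₃ n k) (cong₂ ℤ._+_
        (trans (⊗-distribˡ-⊖ f m₁ m₂ n k) (cong₂ ℤ._-_ (⊗-mono f 1ℤ 0 0 n k) (⊗-mono f (ℤ.+ 3) 1 0 n k)))
        (⊗-mono f (ℤ.+ 2) 2 0 n k)))
      (⊗-mono f 1ℤ 2 1 n k)))
    (⊗-mono f (ℤ.+ 2) 3 1 n k))
  where
  m₁ = mono 1ℤ 0 0
  m₂ = mono (ℤ.+ 3) 1 0
  m₃ = mono (ℤ.+ 2) 2 0
  m₄ = mono 1ℤ 2 1
  m₅ = mono (ℤ.+ 2) 3 1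

numerator-coefficient : ∀ m k →
  numerator (3 + m) k ≡ ℤ.+ (isOne k * d (suc m)) ℤ.- ℤ.+ (isOne k * d m) ℤ.* ℤ.+ 2
numerator-coefficient 0 0             = refl
numerator-coefficient 0 1             = refl
numerator-coefficient 0 (suc (suc k)) = refl
numerator-coefficient 1 0             = refl
numerator-coefficient 1 1             = refl
numerator-coefficient 1 (suc (suc k)) = refl
numerator-coefficient 2 0             = refl
numerator-coefficient 2 1             = refl
numerator-coefficient 2 (suc (suc k)) = refl
numerator-coefficient (suc (suc (suc j))) 0             = refl
numerator-coefficient (suc (suc (suc j))) 1             = sym (doubling-cancels (2 ^ j))
  where
  doubling-cancels : ∀ x → ℤ.+ (1 * (2 * x)) ℤ.- ℤ.+ (1 * x) ℤ.* ℤ.+ 2 ≡ 0ℤ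
  doubling-cancels x = trans
    (cong (λ y → y ℤ.- ℤ.+ (1 * x) ℤ.* ℤ.+ 2) (trans (cong ℤ.+_ (reassociate x)) (ℤₚ.pos-* (1 * x) 2)))
    (ℤₚ.+-inverseʳ (ℤ.+ (1 * x) ℤ.* ℤ.+ 2))
    where
    reassociate : ∀ x → 1 * (2 * x) ≡ 1 * x * 2
    reassociate = solve-∀
numerator-coefficient (suc (suc (suc j))) (suc (suc k)) = refl

recurrence-combination : ∀ {a b} c c′ d′ e₀ e₁ → a ≡ b ℤ.+ c′ ℤ.+ e₁ → b ≡ c ℤ.+ d′ ℤ.+ e₀ →
  a ℤ.* 1ℤ ℤ.- b ℤ.* ℤ.+ 3 ℤ.+ c ℤ.* ℤ.+ 2 ℤ.- c′ ℤ.* 1ℤ ℤ.+ d′ ℤ.* ℤ.+ 2 ≡ e₁ ℤ.- e₀ ℤ.* ℤ.+ 2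
recurrence-combination c c′ d′ e₀ e₁ refl refl = identity c c′ d′ e₀ e₁
  where
  identity : ∀ c c′ d′ e₀ e₁ →
    (c ℤ.+ d′ ℤ.+ e₀ ℤ.+ c′ ℤ.+ e₁) ℤ.* 1ℤ ℤ.- (c ℤ.+ d′ ℤ.+ e₀) ℤ.* ℤ.+ 3 ℤ.+ c ℤ.* ℤ.+ 2
      ℤ.- c′ ℤ.* 1ℤ ℤ.+ d′ ℤ.* ℤ.+ 2 ≡ e₁ ℤ.- e₀ ℤ.* ℤ.+ 2
  identity = solve-∀ℤ

R-times-denominator :
  shift R 0 0 1ℤ ⊖ shift R 1 0 (ℤ.+ 3) ⊕ shift R 2 0 (ℤ.+ 2) ⊖ shift R 2 1 1ℤ ⊕ shift R 3 1 (ℤ.+ 2)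
    ≐ numerator
R-times-denominator 0 k = refl
R-times-denominator 1 k = refl
R-times-denominator 2 0 = refl
R-times-denominator 2 1 = refl
R-times-denominator 2 (suc (suc k)) = refl
R-times-denominator (suc (suc (suc m))) 0
  rewrite r-no-returns (suc (suc (suc m))) | r-no-returns (suc (suc m)) | r-no-returns (suc m) =
  sym (numerator-coefficient m 0)
R-times-denominator (suc (suc (suc m))) (suc k) = begin
  ℤ.+ r (3 + m) (suc k) ℤ.* 1ℤ ℤ.- ℤ.+ r (2 + m) (suc k) ℤ.* ℤ.+ 3 ℤ.+ ℤ.+ r (1 + m) (suc k) ℤ.* ℤ.+ 2
    ℤ.- ℤ.+ r (1 + m) k ℤ.* 1ℤ ℤ.+ ℤ.+ r m k ℤ.* ℤ.+ 2
    ≡⟨ recurrence-combination (ℤ.+ r (1 + m) (suc k)) (ℤ.+ r (1 + m) k) (ℤ.+ r m k)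
         (ℤ.+ (isZero k * d m)) (ℤ.+ (isZero k * d (suc m)))
         (cong ℤ.+_ (r-recurrence (suc m) k)) (cong ℤ.+_ (r-recurrence m k)) ⟩
  ℤ.+ (isZero k * d (suc m)) ℤ.- ℤ.+ (isZero k * d m) ℤ.* ℤ.+ 2
    ≡⟨ numerator-coefficient m (suc k) ⟨
  numerator (3 + m) (suc k) ∎
  where open ≡-Reasoning

theorem12 : (n k : ℕ) →
    (R ⊗ ((one ⊖ (X ⊕ X)) ⊗ (one ⊖ X ⊖ X ⊗ X ⊗ Y))) n k
    ≡ (X ⊗ X ⊗ Y ⊗ (one ⊖ X) ⊗ (one ⊖ X ⊖ X ⊗ X)) n k
theorem12 n k = begin
  (R ⊗ ((one ⊖ (X ⊕ X)) ⊗ (one ⊖ X ⊖ X ⊗ X ⊗ Y))) n k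
    ≡⟨ ⊗-congʳ R denominator-expansion n k ⟩
  (R ⊗ denominator) n k
    ≡⟨ ⊗-denominator R n k ⟩
  (shift R 0 0 1ℤ ⊖ shift R 1 0 (ℤ.+ 3) ⊕ shift R 2 0 (ℤ.+ 2) ⊖ shift R 2 1 1ℤ ⊕ shift R 3 1 (ℤ.+ 2)) n k
    ≡⟨ R-times-denominator n k ⟩
  numerator n k
    ≡⟨ numerator-expansion n k ⟨
  (X ⊗ X ⊗ Y ⊗ (one ⊖ X) ⊗ (one ⊖ X ⊖ X ⊗ X)) n k ∎
  where open ≡-Reasoning
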